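{- Let $G=(V,E)$ be a finite simple graph. Then \[ir_{odd}(G) \leq \gamma_{odd}(G) \leq i_{odd}(G) \leq \beta_{odd}(G) \leq \Gamma_{odd}(G) \leq IR_{odd}(G).\]
   Context: For $S\subseteq V$, $\langle S\rangle$ denotes the subgraph of $G$ induced by $S$. Maximal/minimal are with respect to set inclusion. A set $S$ is odd-cycle independent if $\langle S\rangle$ contains no odd cycle (i.e. is bipartite). $\beta_{odd}(G)$ is the maximum size of an odd-cycle independent set; $i_{odd}(G)$ is the minimum size of a maximal odd-cycle independent set. A set $S$ is odd-cycle dominating if for every $v\in V\setminus S$ there is $u\in S$ such that $u$ and $v$ lie on a common odd cycle of $\langle S\cup\{v\}\rangle$. $\Gamma_{odd}(G)$ is the maximum size of a minimal odd-cycle dominating set; $\gamma_{odd}(G)$ is the minimum size of a minimal odd-cycle dominating set. For $T\subseteq V$ and $x\in V$, say $T$ dominates $x$ if $x\in T$, or $x\notin T$ and there is $w\in T$ such that $x,w$ lie on a common odd cycle of $\langle T\cup\{x\}\rangle$. A set $S$ is odd-cycle irredundant if for every $v\in S$ there exists $u\in (V\setminus S)\cup\{v\}$ such that $S$ dominates $u$ but $S\setminus\{v\}$ does not dominate $u$. $IR_{odd}(G)$ is the maximum size of an odd-cycle irredundant set; $ir_{odd}(G)$ is the minimum size of a maximal odd-cycle irredundant set (one with no odd-cycle irredundant proper superset). -}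

module Defs where

open import Data.Nat using (ℕ; zero; suc; _+_; _*_; _≤_)
open import Data.Fin using (Fin; zero; suc; inject₁; fromℕ)
open import Data.Fin.Subset using (Subset; _∈_; _∉_; _⊂_; _∪_; ⁅_⁆; _-_; ∣_∣)
open import Data.Product using (Σ; ∃; ∃-syntax; _×_; _,_)
open import Data.Sum using (_⊎_)
open import Function.Definitions using (Injective)
open import Relation.Binary.PropositionalEquality using (_≡_)
open import Relation.Nullary using (¬_)

record Graph (n : ℕ) : Set₁ where
  field
    Adj     : Fin n → Fin n → Set
    sym     : ∀ {u v} → Adj u v → Adj v u
    irrefl  : ∀ {u} → ¬ Adj u u

module _ {n : ℕ} (G : Graph n) where
  open Graph G

  record Cycle (m : ℕ) : Set where
    field
      vtx    : Fin (suc m) → Fin n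
      inj    : Injective _≡_ _≡_ vtx
      len≥3  : 2 ≤ m
      step   : ∀ (i : Fin m) → Adj (vtx (inject₁ i)) (vtx (suc i))
      close  : Adj (vtx (fromℕ m)) (vtx zero)

  record OddCycleIn (T : Subset n) : Set where
    field
      half   : ℕ                       -- length = 2 * half + 1
      cyc    : Cycle (2 * half)
      inside : ∀ i → Cycle.vtx cyc i ∈ T

  CommonOddCycle : Subset n → Fin n → Fin n → Set
  CommonOddCycle T u v =
    Σ (OddCycleIn T) λ C →
      (∃[ i ] Cycle.vtx (OddCycleIn.cyc C) i ≡ u) ×
      (∃[ j ] Cycle.vtx (OddCycleIn.cyc C) j ≡ v)

  OddIndependent : Subset n → Set
  OddIndependent S = ¬ OddCycleIn S

  MaximalOddIndependent : Subset n → Set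
  MaximalOddIndependent S =
    OddIndependent S × (∀ T → S ⊂ T → ¬ OddIndependent T)

  OddDominating : Subset n → Set
  OddDominating S =
    ∀ v → v ∉ S → ∃[ u ] (u ∈ S × CommonOddCycle (S ∪ ⁅ v ⁆) u v)

  MinimalOddDominating : Subset n → Set
  MinimalOddDominating S =
    OddDominating S × (∀ T → T ⊂ S → ¬ OddDominating T)

  Dominates : Subset n → Fin n → Set
  Dominates T x =
    x ∈ T ⊎ (x ∉ T × ∃[ w ] (w ∈ T × CommonOddCycle (T ∪ ⁅ x ⁆) x w))

  OddIrredundant : Subset n → Set
  OddIrredundant S =
    ∀ v → v ∈ S → ∃[ u ] ((u ∉ S ⊎ u ≡ v) × Dominates S u × ¬ Dominates (S - v) u)

  MaximalOddIrredundant : Subset n → Set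
  MaximalOddIrredundant S =
    OddIrredundant S × (∀ T → S ⊂ T → ¬ OddIrredundant T)

IsMinSize : {n : ℕ} → (Subset n → Set) → ℕ → Set
IsMinSize P k = (∃[ S ] (P S × ∣ S ∣ ≡ k)) × (∀ S → P S → k ≤ ∣ S ∣)

IsMaxSize : {n : ℕ} → (Subset n → Set) → ℕ → Set
IsMaxSize P k = (∃[ S ] (P S × ∣ S ∣ ≡ k)) × (∀ S → P S → ∣ S ∣ ≤ k)

ir-odd γ-odd i-odd β-odd Γ-odd IR-odd : {n : ℕ} → Graph n → ℕ → Set
ir-odd G k = IsMinSize (MaximalOddIrredundant G) k
γ-odd  G k = IsMinSize (MinimalOddDominating G) k
i-odd  G k = IsMinSize (MaximalOddIndependent G) k
β-odd  G k = IsMaxSize (OddIndependent G) k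
Γ-odd  G k = IsMaxSize (MinimalOddDominating G) k
IR-odd G k = IsMaxSize (OddIrredundant G) k

-- A maximal odd-cycle independent set S is odd-cycle dominating: for v ∉ S the graph
-- ⟨S ∪ {v}⟩ has an odd cycle, which must pass through v, and any other vertex of it lies
-- in S. It is then minimal dominating, since a proper subset T dominating some x ∈ S ∖ T
-- would put an odd cycle inside ⟨T ∪ {x}⟩ ⊆ ⟨S⟩. A minimal odd-cycle dominating set S is
-- irredundant, the witness for v ∈ S being a vertex not dominated by S − v; being
-- dominating it is moreover maximal irredundant, because in a proper superset T ∋ w ∉ S
-- every vertex is already dominated by S ⊆ T − w. Finally a maximum odd-cycle independent
-- set is maximal. Each inequality of the chain then compares a witness of one parameter
-- with the extremal bound of its neighbour. The predicates involve the undecidable adjacency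
-- relation, so the implications hold in the double-negation monad, which suffices since
-- the conclusions m ≤ n are decidable.
module Submission where

open import Defs
open import Data.Nat using (ℕ; suc; _≤_; s≤s; z≤n)
open import Data.Nat.Properties using (_≤?_; <⇒≱; ≤-trans; ≤-reflexive)
open import Data.Product using (_×_; ∃; ∃-syntax; _,_; proj₁)
open import Data.Sum using (_⊎_; inj₁; inj₂; [_,_])
open import Data.Empty using (⊥-elim)
open import Data.Fin using (Fin; zero; punchIn; _≟_)
open import Data.Fin.Properties using (punchInᵢ≢i; ¬∀⟶∃¬; sequence)
open import Data.Fin.Subset using (Subset; _∈_; _∉_; _⊆_; _⊂_; _∪_; ⁅_⁆; _-_; ∣_∣)
open import Data.Fin.Subset.Properties
  using (_∈?_; x∈p∪q⁻; x∈p∪q⁺; x∈⁅x⁆; x∈⁅y⁆⇒x≡y; p⊆p∪q; x∈p∧x≢y⇒x∈p-y; x∈p⇒p-x⊂p; p⊂q⇒∣p∣<∣q∣)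
open import Effect.Monad using (RawMonad)
open import Function using (_∘_; id)
open import Level using (0ℓ)
open import Relation.Nullary using (¬_; yes; no)
open import Relation.Nullary.Negation using (DoubleNegation; ¬¬-Monad; ¬¬-map; contradiction)
open import Relation.Nullary.Decidable using (decidable-stable)
open import Relation.Binary.PropositionalEquality using (_≡_; refl; sym; trans; _≢_)

open RawMonad (¬¬-Monad {0ℓ}) using (pure; rawApplicative)

private
  variable
    n : ℕ
    A B : Set

¬¬-→ : (A → DoubleNegation B) → DoubleNegation (A → B)
¬¬-→ f ¬[a→b] = ¬[a→b] (λ a → ⊥-elim (f a (λ b → ¬[a→b] (λ _ → b))))

¬¬-∀ : {P : Fin n → Set} → (∀ i → DoubleNegation (P i)) → DoubleNegation (∀ i → P i)
¬¬-∀ = sequence rawApplicative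

¬¬-¬∀⇒∃¬ : {P : Fin n → Set} → ¬ (∀ i → P i) → DoubleNegation (∃ λ i → ¬ P i)
¬¬-¬∀⇒∃¬ ¬∀P ¬∃¬P = ¬¬-∀ (λ i ¬Pi → ¬∃¬P (i , ¬Pi)) ¬∀P

otherIndex : ∀ {m} → 1 ≤ m → (i : Fin (suc m)) → ∃ λ j → j ≢ i
otherIndex (s≤s _) i = punchIn i zero , punchInᵢ≢i i zero

x∈p∪⁅y⁆⁻ : ∀ {p : Subset n} {x y} → x ∈ p ∪ ⁅ y ⁆ → x ∈ p ⊎ x ≡ y
x∈p∪⁅y⁆⁻ {p = p} {y = y} x∈ with x∈p∪q⁻ p ⁅ y ⁆ x∈
... | inj₁ x∈p = inj₁ x∈p
... | inj₂ x∈⁅y⁆ = inj₂ (x∈⁅y⁆⇒x≡y y x∈⁅y⁆)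

y∈p∪⁅y⁆ : ∀ (p : Subset n) y → y ∈ p ∪ ⁅ y ⁆
y∈p∪⁅y⁆ p y = x∈p∪q⁺ (inj₂ (x∈⁅x⁆ y))

x∈p∪⁅y⁆∧x∉p⇒x≡y : ∀ {p : Subset n} {x y} → x ∈ p ∪ ⁅ y ⁆ → x ∉ p → x ≡ y
x∈p∪⁅y⁆∧x∉p⇒x≡y x∈ x∉p = [ (λ x∈p → contradiction x∈p x∉p) , id ] (x∈p∪⁅y⁆⁻ x∈)

x∈p∪⁅y⁆∧x≢y⇒x∈p : ∀ {p : Subset n} {x y} → x ∈ p ∪ ⁅ y ⁆ → x ≢ y → x ∈ p
x∈p∪⁅y⁆∧x≢y⇒x∈p x∈ x≢y = [ id , (λ x≡y → contradiction x≡y x≢y) ] (x∈p∪⁅y⁆⁻ x∈)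

p∪⁅x⁆-monoˡ : ∀ {p q : Subset n} {x} → p ⊆ q → p ∪ ⁅ x ⁆ ⊆ q ∪ ⁅ x ⁆
p∪⁅x⁆-monoˡ {q = q} {x} p⊆q y∈ with x∈p∪⁅y⁆⁻ y∈
... | inj₁ y∈p = x∈p∪q⁺ (inj₁ (p⊆q y∈p))
... | inj₂ refl = y∈p∪⁅y⁆ q x

p∪⁅x⁆⊆q : ∀ {p q : Subset n} {x} → p ⊆ q → x ∈ q → p ∪ ⁅ x ⁆ ⊆ q
p∪⁅x⁆⊆q p⊆q x∈q y∈ with x∈p∪⁅y⁆⁻ y∈
... | inj₁ y∈p = p⊆q y∈p
... | inj₂ refl = x∈q

p⊂p∪⁅x⁆ : ∀ {p : Subset n} {x} → x ∉ p → p ⊂ p ∪ ⁅ x ⁆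
p⊂p∪⁅x⁆ {p = p} {x} x∉p = p⊆p∪q ⁅ x ⁆ , x , y∈p∪⁅y⁆ p x , x∉p

p⊆q∧x∉p⇒p⊆q-x : ∀ {p q : Subset n} {x} → p ⊆ q → x ∉ p → p ⊆ q - x
p⊆q∧x∉p⇒p⊆q-x p⊆q x∉p y∈p = x∈p∧x≢y⇒x∈p-y (p⊆q y∈p) λ { refl → x∉p y∈p }

Maximal : (Subset n → Set) → Subset n → Set
Maximal P S = P S × (∀ T → S ⊂ T → ¬ P T)

module _ {P : Subset n → Set} where

  maxSize-maximal : ∀ {k} → IsMaxSize P k → IsMaxSize (Maximal P) k
  maxSize-maximal ((S , PS , ∣S∣≡k) , max) = (S , (PS , S-maximal) , ∣S∣≡k) , λ T → max T ∘ proj₁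
    where
    S-maximal : ∀ T → S ⊂ T → ¬ P T
    S-maximal T S⊂T PT = <⇒≱ (p⊂q⇒∣p∣<∣q∣ S⊂T) (≤-trans (max T PT) (≤-reflexive (sym ∣S∣≡k)))

module _ {P Q : Subset n → Set} (Q⇒P : ∀ {S} → Q S → DoubleNegation (P S)) {a b : ℕ} where

  private
    stable : DoubleNegation (a ≤ b) → a ≤ b
    stable = decidable-stable (a ≤? b)

  minSize≤witness : IsMinSize P a → ∃[ S ] (Q S × ∣ S ∣ ≡ b) → a ≤ b
  minSize≤witness (_ , min) (S , QS , ∣S∣≡b) =
    stable (¬¬-map (λ PS → ≤-trans (min S PS) (≤-reflexive ∣S∣≡b)) (Q⇒P QS))

  witness≤maxSize : ∃[ S ] (Q S × ∣ S ∣ ≡ a) → IsMaxSize P b → a ≤ b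
  witness≤maxSize (S , QS , ∣S∣≡a) (_ , max) =
    stable (¬¬-map (λ PS → ≤-trans (≤-reflexive (sym ∣S∣≡a)) (max S PS)) (Q⇒P QS))

module _ (G : Graph n) where

  oddCycleIn-mono : ∀ {S T} → S ⊆ T → OddCycleIn G S → OddCycleIn G T
  oddCycleIn-mono S⊆T C = record { OddCycleIn C ; inside = S⊆T ∘ OddCycleIn.inside C }

  commonOddCycle-mono : ∀ {S T u v} → S ⊆ T → CommonOddCycle G S u v → CommonOddCycle G T u v
  commonOddCycle-mono S⊆T (C , u∈C , v∈C) = oddCycleIn-mono S⊆T C , u∈C , v∈C

  commonOddCycle-sym : ∀ {S u v} → CommonOddCycle G S u v → CommonOddCycle G S v u
  commonOddCycle-sym (C , u∈C , v∈C) = C , v∈C , u∈C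

  dominates-mono : ∀ {S T x} → S ⊆ T → Dominates G S x → Dominates G T x
  dominates-mono S⊆T (inj₁ x∈S) = inj₁ (S⊆T x∈S)
  dominates-mono {T = T} {x} S⊆T (inj₂ (_ , w , w∈S , c)) with x ∈? T
  ... | yes x∈T = inj₁ x∈T
  ... | no x∉T = inj₂ (x∉T , w , S⊆T w∈S , commonOddCycle-mono (p∪⁅x⁆-monoˡ S⊆T) c)

  oddDominating⇒dominates : ∀ {S} → OddDominating G S → ∀ x → Dominates G S x
  oddDominating⇒dominates {S} dom x with x ∈? S
  ... | yes x∈S = inj₁ x∈S
  ... | no x∉S with dom x x∉S
  ... | w , w∈S , c = inj₂ (x∉S , w , w∈S , commonOddCycle-sym c)

  dominates⇒oddDominating : ∀ {S} → (∀ x → Dominates G S x) → OddDominating G S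
  dominates⇒oddDominating dom v v∉S with dom v
  ... | inj₁ v∈S = contradiction v∈S v∉S
  ... | inj₂ (_ , w , w∈S , c) = w , w∈S , commonOddCycle-sym c

  oddCycle-through : ∀ {S v} → OddIndependent G S → OddCycleIn G (S ∪ ⁅ v ⁆) →
                     ∃[ u ] (u ∈ S × CommonOddCycle G (S ∪ ⁅ v ⁆) u v)
  oddCycle-through {S} {v} indep C =
    let (i , vtxᵢ∉S) = ¬∀⟶∃¬ _ _ (λ i → vtx i ∈? S)
                           (indep ∘ λ inS → record { OddCycleIn C ; inside = inS })
        (j , j≢i) = otherIndex (≤-trans (s≤s z≤n) len≥3) i
        vtxᵢ≡v = x∈p∪⁅y⁆∧x∉p⇒x≡y (inside i) vtxᵢ∉S
        vtxⱼ≢v = λ vtxⱼ≡v → j≢i (inj (trans vtxⱼ≡v (sym vtxᵢ≡v)))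
    in vtx j , x∈p∪⁅y⁆∧x≢y⇒x∈p (inside j) vtxⱼ≢v , C , (j , refl) , (i , vtxᵢ≡v)
    where
    open OddCycleIn C using (cyc; inside)
    open Cycle cyc using (vtx; inj; len≥3)

  maximalOddIndependent⇒oddDominating : ∀ {S} → MaximalOddIndependent G S →
                                         DoubleNegation (OddDominating G S)
  maximalOddIndependent⇒oddDominating {S} (indep , maximal) = ¬¬-∀ λ v → ¬¬-→ λ v∉S →
    ¬¬-map (oddCycle-through indep) (maximal (S ∪ ⁅ v ⁆) (p⊂p∪⁅x⁆ v∉S))

  oddIndependent∧oddDominating⇒minimal : ∀ {S} → OddIndependent G S → OddDominating G S →
                                          MinimalOddDominating G S
  oddIndependent∧oddDominating⇒minimal {S} indep dom = dom , minimal
    where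
    minimal : ∀ T → T ⊂ S → ¬ OddDominating G T
    minimal T (T⊆S , x , x∈S , x∉T) domT with domT x x∉T
    ... | _ , _ , C , _ = indep (oddCycleIn-mono (p∪⁅x⁆⊆q T⊆S x∈S) C)

  maximalOddIndependent⇒minimalOddDominating : ∀ {S} → MaximalOddIndependent G S →
                                                DoubleNegation (MinimalOddDominating G S)
  maximalOddIndependent⇒minimalOddDominating m@(indep , _) =
    ¬¬-map (oddIndependent∧oddDominating⇒minimal indep) (maximalOddIndependent⇒oddDominating m)

  ¬dominates-p-y⇒x∉p⊎x≡y : ∀ {p x y} → ¬ Dominates G (p - y) x → x ∉ p ⊎ x ≡ y
  ¬dominates-p-y⇒x∉p⊎x≡y {x = x} {y} ¬dom with x ≟ y
  ... | yes x≡y = inj₂ x≡y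
  ... | no x≢y = inj₁ (λ x∈p → ¬dom (inj₁ (x∈p∧x≢y⇒x∈p-y x∈p x≢y)))

  minimalOddDominating⇒oddIrredundant : ∀ {S} → MinimalOddDominating G S →
                                         DoubleNegation (OddIrredundant G S)
  minimalOddDominating⇒oddIrredundant {S} (dom , minimal) = ¬¬-∀ λ v → ¬¬-→ λ v∈S →
    ¬¬-map (λ (x , ¬dom) → x , ¬dominates-p-y⇒x∉p⊎x≡y ¬dom , oddDominating⇒dominates dom x , ¬dom)
           (¬¬-¬∀⇒∃¬ (minimal (S - v) (x∈p⇒p-x⊂p v∈S) ∘ dominates⇒oddDominating))

  oddDominating∧oddIrredundant⇒maximal : ∀ {S} → OddDominating G S → OddIrredundant G S →
                                          MaximalOddIrredundant G S
  oddDominating∧oddIrredundant⇒maximal {S} dom irr = irr , maximal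
    where
    maximal : ∀ T → S ⊂ T → ¬ OddIrredundant G T
    maximal T (S⊆T , w , w∈T , w∉S) irrT with irrT w w∈T
    ... | u , _ , _ , ¬dom =
      ¬dom (dominates-mono (p⊆q∧x∉p⇒p⊆q-x S⊆T w∉S) (oddDominating⇒dominates dom u))

  minimalOddDominating⇒maximalOddIrredundant : ∀ {S} → MinimalOddDominating G S →
                                                DoubleNegation (MaximalOddIrredundant G S)
  minimalOddDominating⇒maximalOddIrredundant m@(dom , _) =
    ¬¬-map (oddDominating∧oddIrredundant⇒maximal dom) (minimalOddDominating⇒oddIrredundant m)

mainTheorem2 : {n : ℕ} (G : Graph n) (a b c d e f : ℕ)
    → ir-odd G a → γ-odd G b → i-odd G c → β-odd G d → Γ-odd G e → IR-odd G f
    → a ≤ b × b ≤ c × c ≤ d × d ≤ e × e ≤ f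
mainTheorem2 G a b c d e f ir γ i β Γ IR =
  minSize≤witness (minimalOddDominating⇒maximalOddIrredundant G) ir (proj₁ γ) ,
  minSize≤witness (maximalOddIndependent⇒minimalOddDominating G) γ (proj₁ i) ,
  witness≤maxSize (pure ∘ proj₁) (proj₁ i) β ,
  witness≤maxSize (maximalOddIndependent⇒minimalOddDominating G) (proj₁ (maxSize-maximal β)) Γ ,
  witness≤maxSize (minimalOddDominating⇒oddIrredundant G) (proj₁ Γ) IR
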